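{- The root $r$ of an unknown rooted tree $T=(V,E,r)$ with $|V|=n$ can be found deterministically using path queries in $O(\log\log n)$ rounds and $O(n)$ total queries.
   Context: A rooted tree $T=(V,E,r)$ is an arborescence: a directed graph with root $r$ such that for every non-root vertex $v$ there is exactly one directed path from $r$ to $v$. A path query $path(u,v)$ returns $1$ if there is a directed path from $u$ to $v$ in $T$ and $0$ otherwise. The querier knows only $V$. Queries are issued in rounds; queries in one round are mutually independent (each may depend only on answers from previous rounds). -}

module Defs where

open import Data.Nat using (ℕ; zero; suc; _+_; _*_; _≤_)
open import Data.Nat.Logarithm using (⌊log₂_⌋)
open import Data.Fin using (Fin)
open import Data.Bool using (Bool; true)
open import Data.List using (List; []; _∷_; length; map)
open import Data.Product using (Σ; _×_; _,_; ∃)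
open import Relation.Binary.PropositionalEquality using (_≡_; _≢_)
open import Relation.Binary.Construct.Closure.ReflexiveTransitive using (Star)
open import Function.Bundles using (_⇔_)

Graph : ℕ → Set
Graph n = Fin n → Fin n → Bool

Edge : ∀ {n} → Graph n → Fin n → Fin n → Set
Edge E u v = E u v ≡ true

DirPath : ∀ {n} → Graph n → Fin n → Fin n → Set
DirPath E = Star (Edge E)

IsArborescence : ∀ {n} → Graph n → Fin n → Set
IsArborescence E r =
  ∀ v → v ≢ r → Σ (DirPath E r v) (λ p → ∀ (p′ : DirPath E r v) → p′ ≡ p)

Oracle : ℕ → Set
Oracle n = Fin n → Fin n → Bool

IsPathOracle : ∀ {n} → Graph n → Oracle n → Set
IsPathOracle E path = ∀ u v → (path u v ≡ true) ⇔ DirPath E u v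

-- A deterministic round-based querier knowing only the vertex set Fin n.
-- In each round it issues a list of queries (chosen from the answers of
-- previous rounds only) and receives all their answers at once;
-- eventually it outputs a vertex.
data Protocol (n : ℕ) : Set where
  output : Fin n → Protocol n
  round  : (qs : List (Fin n × Fin n)) → (List Bool → Protocol n) → Protocol n

answers : ∀ {n} → Oracle n → List (Fin n × Fin n) → List Bool
answers path [] = []
answers path ((u , v) ∷ qs) = path u v ∷ answers path qs

run : ∀ {n} → Protocol n → Oracle n → Fin n
run (output x) path = x
run (round qs k) path = run (k (answers path qs)) path

rounds : ∀ {n} → Protocol n → Oracle n → ℕ
rounds (output x) path = 0
rounds (round qs k) path = suc (rounds (k (answers path qs)) path)

queries : ∀ {n} → Protocol n → Oracle n → ℕ
queries (output x) path = 0
queries (round qs k) path = length qs + queries (k (answers path qs)) path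

module Submission where

-- Only two properties of the root r are used (IsRoot): r reaches every
-- vertex, and no other vertex reaches r (else r → u → r → u would be a
-- second path from r to u).  So in a group of candidates containing r,
-- querying all pairs inside the group singles r out.  A tournament splits
-- the s candidates into q groups of size g (s ≤ q * g), queries all pairs
-- inside every group (q · g² queries) and keeps each group's winner; a
-- Schedule records the (q, g) of each round.  For n + 1 ≤ 2^M vertices we
-- use K = 1 + ⌊log₂ ⌊log₂ (n+1)⌋⌋ halving rounds (groups of 2, 4 · 2^M
-- queries in total), then at most K + 1 squaring rounds with groups of
-- size 2, 2², 2⁴, … (each 2^(M∸K+1) queries, 2 · 2^M in total as
-- K + 1 ≤ 2^K): 2K + 1 rounds and 6 · 2^M ≤ 12 (n + 1) queries.

open import Defs
open import Data.Nat using (ℕ; zero; suc; _+_; _*_; _∸_; _^_; _≤_; _<_; z≤n; s≤s; ⌊_/2⌋; _≤?_; _<?_)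
open import Data.Nat.Properties hiding (_≟_)
open import Data.Nat.Logarithm using (⌊log₂_⌋; ⌊log₂⌋-mono-≤; ⌊log₂[2^n]⌋≡n)
open import Data.Nat.Logarithm.Core using (⌊log2⌋)
open import Data.Nat.Tactic.RingSolver using (solve-∀)
open import Data.Fin using (Fin; zero; toℕ; fromℕ<; combine; remQuot; _≟_)
open import Data.Fin.Properties using (toℕ-fromℕ<; toℕ-injective; toℕ<n; combine-remQuot)
open import Data.Bool using (Bool; true; false; T; if_then_else_)
open import Data.Bool.Properties using (T-≡)
open import Data.List using (List; []; _∷_; length; map; _++_; concatMap; allFin; cartesianProduct)
open import Data.Bool.ListAction using (all)
open import Data.List.Properties using (length-++; length-map; length-tabulate)
open import Data.List.Membership.Propositional using (_∈_)
open import Data.List.Membership.Propositional.Properties using (∈-map⁺; ∈-allFin; ∈-cartesianProduct⁺; ∈-concat⁺′)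
open import Data.List.Relation.Unary.Any using (here; there)
import Data.List.Relation.Unary.All as All
open import Data.List.Relation.Unary.All.Properties using (all⁺; all⁻)
open import Data.Product using (Σ; _×_; _,_; proj₁; proj₂)
open import Data.Product.Properties using (≡-dec)
open import Data.Empty using (⊥-elim)
open import Relation.Nullary using (yes; no)
open import Relation.Binary.PropositionalEquality
open import Relation.Binary.Construct.Closure.ReflexiveTransitive using (Star; ε; _◅_; _◅◅_)
open import Induction.WellFounded using (Acc; acc)
open import Function.Bundles using (Equivalence)

record IsRoot {m : ℕ} (path : Oracle m) (r : Fin m) : Set where
  field
    reachesAll : ∀ w → path r w ≡ true
    onlyRoot   : ∀ u → path u r ≡ true → u ≡ r

module _ {A : Set} {R : A → A → Set} where

  ◅-injective : ∀ {x y z} {e : R x y} {p p′ : Star R y z} → e ◅ p ≡ e ◅ p′ → p ≡ p′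
  ◅-injective refl = refl

  ◅◅-cancel : ∀ {x y} (p : Star R x y) (c : Star R y y) → p ◅◅ c ≡ p → c ≡ ε
  ◅◅-cancel ε       c eq = eq
  ◅◅-cancel (e ◅ p) c eq = ◅◅-cancel p c (◅-injective eq)

  round-trip-nonempty : ∀ {x y} (q : Star R x y) (p : Star R y x) → x ≢ y → q ◅◅ p ≢ ε
  round-trip-nonempty ε       p x≢y _  = x≢y refl
  round-trip-nonempty (e ◅ q) p _   ()

arborescence-root : ∀ {m} {E : Graph m} {r : Fin m} {path : Oracle m} →
                    IsArborescence E r → IsPathOracle E path → IsRoot path r
arborescence-root {E = E} {r} {path} arb orc = record { reachesAll = reachesAll ; onlyRoot = onlyRoot }
  where
  reachesAll : ∀ w → path r w ≡ true
  reachesAll w with w ≟ r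
  ... | yes refl = Equivalence.from (orc r r) ε
  ... | no w≢r   = Equivalence.from (orc r w) (proj₁ (arb w w≢r))

  -- If u ≠ r reached r by q, then p ◅◅ q ◅◅ p would be a second path r → u.
  onlyRoot : ∀ u → path u r ≡ true → u ≡ r
  onlyRoot u ur with u ≟ r
  ... | yes u≡r = u≡r
  ... | no u≢r  = ⊥-elim (round-trip-nonempty q p u≢r (◅◅-cancel p (q ◅◅ p) (unique (p ◅◅ q ◅◅ p))))
    where
    p : DirPath E r u
    p = proj₁ (arb u u≢r)
    unique : ∀ p′ → p′ ≡ p
    unique = proj₂ (arb u u≢r)
    q : DirPath E u r
    q = Equivalence.to (orc u r) ur

firstWith : {A : Set} → (A → Bool) → A → List A → A
firstWith p d []       = d
firstWith p d (x ∷ xs) = if p x then x else firstWith p d xs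

firstWith-unique : {A : Set} (p : A → Bool) (d : A) (xs : List A) {x : A} →
                   x ∈ xs → T (p x) → (∀ y → y ∈ xs → T (p y) → y ≡ x) →
                   firstWith p d xs ≡ x
firstWith-unique p d (y ∷ xs) x∈ px unique with p y in py
... | true  = unique y (here refl) (Equivalence.from T-≡ py)
... | false with x∈
...   | here refl = ⊥-elim (subst T py px)
...   | there x∈′ = firstWith-unique p d xs x∈′ px (λ z z∈ → unique z (there z∈))

length-cartesianProduct : {A B : Set} (xs : List A) (ys : List B) →
                          length (cartesianProduct xs ys) ≡ length xs * length ys
length-cartesianProduct []       ys = refl
length-cartesianProduct (x ∷ xs) ys = begin
  length (map (x ,_) ys ++ cartesianProduct xs ys)          ≡⟨ length-++ (map (x ,_) ys) ⟩
  length (map (x ,_) ys) + length (cartesianProduct xs ys)  ≡⟨ cong₂ _+_ (length-map (x ,_) ys) (length-cartesianProduct xs ys) ⟩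
  length ys + length xs * length ys                         ∎
  where open ≡-Reasoning

length-concatMap : {A B : Set} (h : A → List B) (c : ℕ) → (∀ a → length (h a) ≡ c) →
                   (xs : List A) → length (concatMap h xs) ≡ length xs * c
length-concatMap h c hc []       = refl
length-concatMap h c hc (a ∷ xs) = trans (length-++ (h a)) (cong₂ _+_ (hc a) (length-concatMap h c hc xs))

-- A schedule for s candidates: in each round the candidates are split
-- into q groups of size g, leaving q candidates, until one is left.
data Schedule : ℕ → Set where
  done  : Schedule 1
  split : ∀ {s} (q g : ℕ) → s ≤ q * g → Schedule q → Schedule s

depth : ∀ {s} → Schedule s → ℕ
depth done              = 0
depth (split q g _ sc)  = suc (depth sc)

cost : ∀ {s} → Schedule s → ℕ
cost done             = 0
cost (split q g _ sc) = q * (g * g) + cost sc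

-- The tournament protocol driven by a schedule

module Tournament {n : ℕ} where

  Vertex : Set
  Vertex = Fin (suc n)

  Query : Set
  Query = Vertex × Vertex

  pad : ∀ {s m} → (Fin s → Vertex) → Fin m → Vertex
  pad {s} f x with toℕ x <? s
  ... | yes x<s = f (fromℕ< x<s)
  ... | no _    = zero

  pad-agrees : ∀ {s m} (f : Fin s → Vertex) (k : Fin s) (x : Fin m) → toℕ x ≡ toℕ k → pad f x ≡ f k
  pad-agrees {s} f k x x≡k with toℕ x <? s
  ... | yes x<s = cong f (toℕ-injective (trans (toℕ-fromℕ< x<s) x≡k))
  ... | no x≮s  = ⊥-elim (x≮s (subst (_< s) (sym x≡k) (toℕ<n k)))

  group : ∀ {s} → (Fin s → Vertex) → (q g : ℕ) → Fin q → List Vertex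
  group f q g i = map (λ j → pad f (combine i j)) (allFin g)

  pairsIn : List Vertex → List Query
  pairsIn G = cartesianProduct G G

  roundQueries : ∀ {s} → (Fin s → Vertex) → (q g : ℕ) → List Query
  roundQueries f q g = concatMap (λ i → pairsIn (group f q g i)) (allFin q)

  lookupAnswer : List Query → List Bool → Query → Bool
  lookupAnswer (y ∷ qs) (b ∷ bs) x with ≡-dec _≟_ _≟_ y x
  ... | yes _ = b
  ... | no _  = lookupAnswer qs bs x
  lookupAnswer _ _ _ = false

  winner : (Query → Bool) → List Vertex → Vertex
  winner ans G = firstWith (λ u → all (λ w → ans (u , w)) G) zero G

  survivors : ∀ {s} → (Fin s → Vertex) → (q g : ℕ) → List Bool → Fin q → Vertex
  survivors f q g bs i = winner (lookupAnswer (roundQueries f q g) bs) (group f q g i)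

  tournament : ∀ {s} → Schedule s → (Fin s → Vertex) → Protocol (suc n)
  tournament done             f = output (f zero)
  tournament (split q g _ sc) f = round (roundQueries f q g) (λ bs → tournament sc (survivors f q g bs))

  rounds-tournament : ∀ path {s} (sc : Schedule s) f → rounds (tournament sc f) path ≡ depth sc
  rounds-tournament path done             f = refl
  rounds-tournament path (split q g _ sc) f = cong suc (rounds-tournament path sc _)

  length-roundQueries : ∀ {s} (f : Fin s → Vertex) q g → length (roundQueries f q g) ≡ q * (g * g)
  length-roundQueries f q g =
    trans (length-concatMap (λ i → pairsIn (group f q g i)) (g * g) pairs-length (allFin q))
          (cong (_* (g * g)) (length-tabulate {n = q} (λ i → i)))
    where
    group-length : ∀ i → length (group f q g i) ≡ g
    group-length i = trans (length-map _ (allFin g)) (length-tabulate (λ j → j))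
    pairs-length : ∀ i → length (pairsIn (group f q g i)) ≡ g * g
    pairs-length i = trans (length-cartesianProduct (group f q g i) _) (cong₂ _*_ (group-length i) (group-length i))

  queries-tournament : ∀ path {s} (sc : Schedule s) f → queries (tournament sc f) path ≡ cost sc
  queries-tournament path done             f = refl
  queries-tournament path (split q g _ sc) f = cong₂ _+_ (length-roundQueries f q g) (queries-tournament path sc _)

  lookupAnswer-correct : ∀ (path : Oracle (suc n)) qs {u w} → (u , w) ∈ qs →
                         lookupAnswer qs (answers path qs) (u , w) ≡ path u w
  lookupAnswer-correct path (y ∷ qs) {u} {w} uw∈ with ≡-dec _≟_ _≟_ y (u , w)
  ... | yes refl = refl
  ... | no y≢uw with uw∈
  ...   | here uw≡y  = ⊥-elim (y≢uw (sym uw≡y))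
  ...   | there uw∈′ = lookupAnswer-correct path qs uw∈′

  winner-root : ∀ {path r} → IsRoot path r → (ans : Query → Bool) (G : List Vertex) →
                (∀ {u w} → u ∈ G → w ∈ G → ans (u , w) ≡ path u w) → r ∈ G → winner ans G ≡ r
  winner-root {path} {r} root ans G correct r∈G =
    firstWith-unique reachesGroup zero G r∈G r-reaches only-r
    where
    open IsRoot root
    reachesGroup : Vertex → Bool
    reachesGroup u = all (λ w → ans (u , w)) G
    r-reaches : T (reachesGroup r)
    r-reaches = all⁻ (λ w → ans (r , w))
      (All.tabulate (λ w∈G → Equivalence.from T-≡ (trans (correct r∈G w∈G) (reachesAll _))))
    only-r : ∀ u → u ∈ G → T (reachesGroup u) → u ≡ r
    only-r u u∈G u-reaches = onlyRoot u (trans (sym (correct u∈G r∈G))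
      (Equivalence.to T-≡ (All.lookup (all⁺ (λ w → ans (u , w)) G u-reaches) r∈G)))

  candidate-in-group : ∀ {s} (f : Fin s → Vertex) (q g : ℕ) → s ≤ q * g → (k : Fin s) →
                       Σ (Fin q) λ i → f k ∈ group f q g i
  candidate-in-group f q g s≤qg k = i , subst (_∈ group f q g i) padded (∈-map⁺ _ (∈-allFin j))
    where
    x : Fin (q * g)
    x = fromℕ< (≤-trans (toℕ<n k) s≤qg)
    i : Fin q
    i = proj₁ (remQuot {q} g x)
    j : Fin g
    j = proj₂ (remQuot {q} g x)
    padded : pad f (combine i j) ≡ f k
    padded = trans (cong (pad f) (combine-remQuot {q} g x)) (pad-agrees f k x (toℕ-fromℕ< _))

  tournament-correct : ∀ {path r} → IsRoot path r → ∀ {s} (sc : Schedule s) (f : Fin s → Vertex) →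
                       (Σ (Fin s) λ k → f k ≡ r) → run (tournament sc f) path ≡ r
  tournament-correct root done f (zero , fk≡r) = fk≡r
  tournament-correct {path} {r} root (split q g s≤qg sc) f (k , fk≡r) =
    tournament-correct root sc (survivors f q g (answers path qs)) (i , wins)
    where
    qs : List Query
    qs = roundQueries f q g
    i : Fin q
    i = proj₁ (candidate-in-group f q g s≤qg k)
    G : List Vertex
    G = group f q g i
    r∈G : r ∈ G
    r∈G = subst (_∈ G) fk≡r (proj₂ (candidate-in-group f q g s≤qg k))
    correct : ∀ {u w} → u ∈ G → w ∈ G → lookupAnswer qs (answers path qs) (u , w) ≡ path u w
    correct u∈G w∈G = lookupAnswer-correct path qs
      (∈-concat⁺′ (∈-cartesianProduct⁺ u∈G w∈G) (∈-map⁺ (λ i → pairsIn (group f q g i)) (∈-allFin i)))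
    wins : survivors f q g (answers path qs) i ≡ r
    wins = winner-root root _ G correct r∈G

-- Powers of two and logarithms

1+n≤2^n : ∀ n → suc n ≤ 2 ^ n
1+n≤2^n zero    = s≤s z≤n
1+n≤2^n (suc n) = +-mono-≤ (m^n>0 2 n) (≤-trans (1+n≤2^n n) (≤-reflexive (sym (+-identityʳ (2 ^ n)))))

⌊log₂n⌋≤n : ∀ n → ⌊log₂ n ⌋ ≤ n
⌊log₂n⌋≤n n = ≤-trans (⌊log₂⌋-mono-≤ (≤-trans (n≤1+n n) (1+n≤2^n n))) (≤-reflexive (⌊log₂[2^n]⌋≡n n))

-- Upper bound from the floor logarithm: otherwise ⌊log₂ n⌋ + 1 ≤ ⌊log₂ n⌋.
n<2^[1+⌊log₂n⌋] : ∀ n → n < 2 ^ suc ⌊log₂ n ⌋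
n<2^[1+⌊log₂n⌋] n with 2 ^ suc ⌊log₂ n ⌋ ≤? n
... | no  2^≰n = ≰⇒> 2^≰n
... | yes 2^≤n = ⊥-elim (1+n≰n (≤-trans (≤-reflexive (sym (⌊log₂[2^n]⌋≡n _))) (⌊log₂⌋-mono-≤ 2^≤n)))

2^⌊log₂[1+n]⌋≤1+n : ∀ n → 2 ^ ⌊log₂ suc n ⌋ ≤ suc n
2^⌊log₂[1+n]⌋≤1+n n = bound n _
  where
  half+half≤ : ∀ m → ⌊ m /2⌋ + ⌊ m /2⌋ ≤ m
  half+half≤ m = ≤-trans (+-monoʳ-≤ ⌊ m /2⌋ (⌊n/2⌋≤⌈n/2⌉ m)) (≤-reflexive (⌊n/2⌋+⌈n/2⌉≡n m))
  double-suc : ∀ h → 2 * suc h ≡ suc (suc (h + h))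
  double-suc = solve-∀
  bound : ∀ m (a : Acc _<_ (suc m)) → 2 ^ ⌊log2⌋ (suc m) a ≤ suc m
  bound zero    _        = ≤-refl
  bound (suc m) (acc rs) = begin
    2 * 2 ^ ⌊log2⌋ (suc ⌊ m /2⌋) _  ≤⟨ *-monoʳ-≤ 2 (bound ⌊ m /2⌋ _) ⟩
    2 * suc ⌊ m /2⌋                 ≡⟨ double-suc ⌊ m /2⌋ ⟩
    suc (suc (⌊ m /2⌋ + ⌊ m /2⌋))   ≤⟨ s≤s (s≤s (half+half≤ m)) ⟩
    suc (suc m)                     ∎
    where open ≤-Reasoning

2^-split : ∀ e d → d ≤ e → 2 ^ e ≡ 2 ^ (e ∸ d) * 2 ^ d
2^-split e d d≤e = trans (cong (2 ^_) (sym (m∸n+n≡m d≤e))) (^-distribˡ-+-* 2 (e ∸ d) d)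

-- Halving and squaring schedules

Scheduler : ℕ → Set
Scheduler e = ∀ {s} → s ≤ 2 ^ e → Schedule s

single : ∀ e → Scheduler e
single e s≤ = split 1 (2 ^ e) (≤-trans s≤ (≤-reflexive (sym (*-identityˡ _)))) done

cost-single : ∀ e d {s} (s≤ : s ≤ 2 ^ e) → e ≤ d → cost (single e s≤) ≤ 2 ^ (e + d)
cost-single e d _ e≤d = begin
  1 * (2 ^ e * 2 ^ e) + 0 ≡⟨ trans (+-identityʳ _) (*-identityˡ _) ⟩
  2 ^ e * 2 ^ e           ≤⟨ *-monoʳ-≤ (2 ^ e) (^-monoʳ-≤ 2 e≤d) ⟩
  2 ^ e * 2 ^ d           ≡⟨ sym (^-distribˡ-+-* 2 e d) ⟩
  2 ^ (e + d)             ∎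
  where open ≤-Reasoning

splitPow : ∀ e d → d ≤ e → Schedule (2 ^ (e ∸ d)) → Scheduler e
splitPow e d d≤e next s≤ = split (2 ^ (e ∸ d)) (2 ^ d) (≤-trans s≤ (≤-reflexive (2^-split e d d≤e))) next

cost-splitPow : ∀ e d (d≤e : d ≤ e) next {s} (s≤ : s ≤ 2 ^ e) →
                cost (splitPow e d d≤e next s≤) ≡ 2 ^ (e + d) + cost next
cost-splitPow e d d≤e next _ = cong (_+ cost next) (begin
  2 ^ (e ∸ d) * (2 ^ d * 2 ^ d) ≡⟨ sym (*-assoc (2 ^ (e ∸ d)) _ _) ⟩
  2 ^ (e ∸ d) * 2 ^ d * 2 ^ d   ≡⟨ cong (_* 2 ^ d) (sym (2^-split e d d≤e)) ⟩
  2 ^ e * 2 ^ d                 ≡⟨ sym (^-distribˡ-+-* 2 e d) ⟩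
  2 ^ (e + d)                   ∎)
  where open ≡-Reasoning

-- Squaring: groups of size 2^d, doubling d each round, so the exponent
-- sum e + d is invariant; at most j + 1 rounds.
squaring : (j e d : ℕ) → Scheduler e
squaring zero    e d = single e
squaring (suc j) e d with e ≤? d
... | yes _   = single e
... | no e≰d  = splitPow e d (<⇒≤ (≰⇒> e≰d)) (squaring j (e ∸ d) (d + d) ≤-refl)

depth-squaring : ∀ j e d {s} (s≤ : s ≤ 2 ^ e) → depth (squaring j e d s≤) ≤ suc j
depth-squaring zero    e d s≤ = ≤-refl
depth-squaring (suc j) e d s≤ with e ≤? d
... | yes _  = s≤s z≤n
... | no _   = s≤s (depth-squaring j (e ∸ d) (d + d) ≤-refl)

cost-squaring : ∀ j e d {s} (s≤ : s ≤ 2 ^ e) → e ≤ 2 ^ j * d → cost (squaring j e d s≤) ≤ suc j * 2 ^ (e + d)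
cost-squaring zero    e d s≤ e≤1*d = ≤-trans (cost-single e d s≤ (≤-trans e≤1*d (≤-reflexive (*-identityˡ d))))
                                             (≤-reflexive (sym (+-identityʳ _)))
cost-squaring (suc j) e d s≤ e≤ with e ≤? d
... | yes e≤d = ≤-trans (cost-single e d s≤ e≤d) (m≤m+n _ _)
... | no e≰d  = begin
  cost (splitPow e d d≤e next s≤)         ≡⟨ cost-splitPow e d d≤e next s≤ ⟩
  2 ^ (e + d) + cost next                 ≤⟨ +-monoʳ-≤ (2 ^ (e + d)) (cost-squaring j (e ∸ d) (d + d) ≤-refl invariant) ⟩
  2 ^ (e + d) + suc j * 2 ^ (e ∸ d + (d + d)) ≡⟨ cong (λ x → 2 ^ (e + d) + suc j * 2 ^ x) exponent ⟩
  2 ^ (e + d) + suc j * 2 ^ (e + d)       ∎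
  where
  open ≤-Reasoning
  d≤e : d ≤ e
  d≤e = <⇒≤ (≰⇒> e≰d)
  next : Schedule (2 ^ (e ∸ d))
  next = squaring j (e ∸ d) (d + d) ≤-refl
  exponent : e ∸ d + (d + d) ≡ e + d
  exponent = trans (sym (+-assoc (e ∸ d) d d)) (cong (_+ d) (m∸n+n≡m d≤e))
  doubling : ∀ a d → 2 * a * d ≡ a * (d + d)
  doubling = solve-∀
  invariant : e ∸ d ≤ 2 ^ j * (d + d)
  invariant = ≤-trans (m∸n≤m e d) (≤-trans e≤ (≤-reflexive (doubling (2 ^ j) d)))

halving : (j e : ℕ) → Scheduler (e ∸ j) → Scheduler e
halving zero    e       next = next
halving (suc j) zero    next = next
halving (suc j) (suc e) next = splitPow (suc e) 1 (s≤s z≤n) (halving j e next ≤-refl)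

depth-halving : ∀ j e (next : Scheduler (e ∸ j)) Y → (∀ {s} (s≤ : s ≤ 2 ^ (e ∸ j)) → depth (next s≤) ≤ Y) →
                ∀ {s} (s≤ : s ≤ 2 ^ e) → depth (halving j e next s≤) ≤ j + Y
depth-halving zero    e       next Y hY s≤ = hY s≤
depth-halving (suc j) zero    next Y hY s≤ = ≤-trans (hY s≤) (m≤n+m Y (suc j))
depth-halving (suc j) (suc e) next Y hY s≤ = s≤s (depth-halving j e next Y hY ≤-refl)

-- The halving rounds cost a geometric sum, at most 4 · 2^e.
cost-halving : ∀ j e (next : Scheduler (e ∸ j)) X → (∀ {s} (s≤ : s ≤ 2 ^ (e ∸ j)) → cost (next s≤) ≤ X) →
               ∀ {s} (s≤ : s ≤ 2 ^ e) → cost (halving j e next s≤) ≤ 4 * 2 ^ e + X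
cost-halving zero    e       next X hX s≤ = ≤-trans (hX s≤) (m≤n+m X _)
cost-halving (suc j) zero    next X hX s≤ = ≤-trans (hX s≤) (m≤n+m X _)
cost-halving (suc j) (suc e) next X hX s≤ = begin
  cost (splitPow (suc e) 1 (s≤s z≤n) rest s≤) ≡⟨ cost-splitPow (suc e) 1 (s≤s z≤n) rest s≤ ⟩
  2 ^ (suc e + 1) + cost rest          ≤⟨ +-monoʳ-≤ (2 ^ (suc e + 1)) (cost-halving j e next X hX ≤-refl) ⟩
  2 ^ (suc e + 1) + (4 * 2 ^ e + X)    ≡⟨ cong (λ x → 2 ^ x + (4 * 2 ^ e + X)) (+-comm (suc e) 1) ⟩
  2 ^ (2 + e) + (4 * 2 ^ e + X)        ≡⟨ geometric (2 ^ e) X ⟩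
  4 * 2 ^ suc e + X                    ∎
  where
  open ≤-Reasoning
  rest : Schedule (2 ^ e)
  rest = halving j e next ≤-refl
  geometric : ∀ a x → 2 * (2 * a) + (4 * a + x) ≡ 4 * (2 * a) + x
  geometric = solve-∀

module RootSchedule (n : ℕ) where

  L k K M : ℕ
  L = ⌊log₂ suc n ⌋
  k = ⌊log₂ L ⌋
  K = suc k      -- halving rounds; at most K + 1 squaring rounds follow
  M = suc L

  n+1≤2^M : suc n ≤ 2 ^ M
  n+1≤2^M = <⇒≤ (n<2^[1+⌊log₂n⌋] (suc n))

  schedule : Schedule (suc n)
  schedule = halving K M (squaring K (M ∸ K) 1) n+1≤2^M

  -- K + (K + 1) rounds.
  depth-schedule : depth schedule ≤ 12 * k + 12
  depth-schedule = ≤-trans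
    (depth-halving K M _ (suc K) (depth-squaring K (M ∸ K) 1) n+1≤2^M)
    (≤-trans (m≤m+n (K + suc K) (10 * k + 9)) (≤-reflexive (rounds-sum k)))
    where
    rounds-sum : ∀ k → suc k + suc (suc k) + (10 * k + 9) ≡ 12 * k + 12
    rounds-sum = solve-∀

  -- After halving, M ∸ K ≤ M ≤ 2^K, the squaring invariant with d = 1.
  squaring-start : M ∸ K ≤ 2 ^ K * 1
  squaring-start = ≤-trans (m∸n≤m M K) (≤-trans (n<2^[1+⌊log₂n⌋] L) (≤-reflexive (sym (*-identityʳ _))))

  -- The squaring phase costs at most 2 · 2^M, since K + 1 ≤ 2^K.
  squaring-bound : suc K * 2 ^ (M ∸ K + 1) ≤ 2 * 2 ^ M
  squaring-bound = begin
    suc K * 2 ^ (M ∸ K + 1) ≤⟨ *-monoˡ-≤ _ (1+n≤2^n K) ⟩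
    2 ^ K * 2 ^ (M ∸ K + 1) ≡⟨ sym (^-distribˡ-+-* 2 K _) ⟩
    2 ^ (K + (M ∸ K + 1))   ≡⟨ cong (2 ^_) (trans (sym (+-assoc K (M ∸ K) 1)) (cong (_+ 1) (m+[n∸m]≡n K≤M))) ⟩
    2 ^ (M + 1)             ≡⟨ cong (2 ^_) (+-comm M 1) ⟩
    2 * 2 ^ M               ∎
    where
    open ≤-Reasoning
    K≤M : K ≤ M
    K≤M = s≤s (⌊log₂n⌋≤n L)

  -- 4 · 2^M + 2 · 2^M = 12 · 2^⌊log₂ (n+1)⌋ ≤ 12 (n + 1) queries.
  cost-schedule : cost schedule ≤ 12 * suc n + 12
  cost-schedule = begin
    cost schedule                            ≤⟨ cost-halving K M _ (suc K * 2 ^ (M ∸ K + 1)) (λ s≤ → cost-squaring K (M ∸ K) 1 s≤ squaring-start) n+1≤2^M ⟩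
    4 * 2 ^ M + suc K * 2 ^ (M ∸ K + 1)      ≤⟨ +-monoʳ-≤ (4 * 2 ^ M) squaring-bound ⟩
    4 * 2 ^ M + 2 * 2 ^ M                    ≡⟨ total (2 ^ L) ⟩
    12 * 2 ^ L                               ≤⟨ *-monoʳ-≤ 12 (2^⌊log₂[1+n]⌋≤1+n n) ⟩
    12 * suc n                               ≤⟨ m≤m+n _ 12 ⟩
    12 * suc n + 12                          ∎
    where
    open ≤-Reasoning
    total : ∀ a → 4 * (2 * a) + 2 * (2 * a) ≡ 12 * a
    total = solve-∀

findRoot : (n : ℕ) → Protocol (suc n)
findRoot n = Tournament.tournament (RootSchedule.schedule n) (λ v → v)

corollary10 : Σ ℕ λ C → Σ ((n : ℕ) → Protocol (suc n)) λ A →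
    ∀ (n : ℕ) (E : Graph (suc n)) (r : Fin (suc n)) (path : Oracle (suc n)) →
    IsArborescence E r → IsPathOracle E path →
    (run (A n) path ≡ r)
    × (rounds (A n) path ≤ C * ⌊log₂ ⌊log₂ suc n ⌋ ⌋ + C)
    × (queries (A n) path ≤ C * suc n + C)
corollary10 = 12 , findRoot , λ n E r path arb orc →
    Tournament.tournament-correct (arborescence-root arb orc) (RootSchedule.schedule n) (λ v → v) (r , refl)
  , subst (_≤ 12 * ⌊log₂ ⌊log₂ suc n ⌋ ⌋ + 12) (sym (Tournament.rounds-tournament path (RootSchedule.schedule n) _))
          (RootSchedule.depth-schedule n)
  , subst (_≤ 12 * suc n + 12) (sym (Tournament.queries-tournament path (RootSchedule.schedule n) _))
          (RootSchedule.cost-schedule n)
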